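{- Let $f\colon\{0,1\}^n\to\{0,1,\perp\}$ be a partial function and $F(x,y)=f(x\oplus y)$. If $\mathrm{D_{cc}^{\rightarrow}}(F)=1$, then $\mathrm{NADT^{\oplus}}(f)=1$.
   Context: $\operatorname{Dom}(f)=f^{ -1}(\{0,1\})$, $\oplus$ is bitwise XOR, $\operatorname{Dom}(F)=\{(x,y):x\oplus y\in\operatorname{Dom}(f)\}$. $\mathrm{D_{cc}^{\rightarrow}}(F)$ is the minimum $t$ such that there are total $h\colon\{0,1\}^n\to\{0,1\}^t$ and $\varphi\colon\{0,1\}^t\times\{0,1\}^n\to\{0,1\}$ with $\varphi(h(x),y)=F(x,y)$ for all $(x,y)\in\operatorname{Dom}(F)$. With $\langle s,x\rangle=\bigoplus_is_i\wedge x_i$, $\mathrm{NADT^{\oplus}}(f)$ is the minimum $p$ such that there are $s_1,\dots,s_p\in\{0,1\}^n$ and total $l\colon\{0,1\}^p\to\{0,1\}$ with $l(\langle s_1,x\rangle,\dots,\langle s_p,x\rangle)=f(x)$ for all $x\in\operatorname{Dom}(f)$. -}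

module Defs where

open import Data.Nat using (ℕ)
open import Data.Bool using (Bool; true; false; _xor_; _∧_)
open import Data.Maybe using (Maybe; just; nothing)
open import Data.Vec using (Vec; zipWith; foldr; map)
open import Data.Product using (Σ; _×_; _,_)
open import Relation.Binary.PropositionalEquality using (_≡_)
open import Relation.Nullary using (¬_)

-- Bit strings {0,1}^n are Vec Bool n; true = 1, false = 0.
-- A partial function f : {0,1}^n → {0,1,⊥} is Vec Bool n → Maybe Bool,
-- with nothing = ⊥.  Dom(f) = { x | f x ≡ just b for some b }.
PartialFn : ℕ → Set
PartialFn n = Vec Bool n → Maybe Bool

_⊕_ : ∀ {n} → Vec Bool n → Vec Bool n → Vec Bool n
x ⊕ y = zipWith _xor_ x y

⟨_,_⟩ : ∀ {n} → Vec Bool n → Vec Bool n → Bool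
⟨ s , x ⟩ = foldr _ _xor_ false (zipWith _∧_ s x)

xorLift : ∀ {n} → PartialFn n → Vec Bool n → Vec Bool n → Maybe Bool
xorLift f x y = f (x ⊕ y)

OneWayProtocol : ∀ {n} → (Vec Bool n → Vec Bool n → Maybe Bool) → ℕ → Set
OneWayProtocol {n} F t =
  Σ (Vec Bool n → Vec Bool t) λ h →
  Σ (Vec Bool t → Vec Bool n → Bool) λ φ →
    ∀ x y b → F x y ≡ just b → φ (h x) y ≡ b

Dcc→ : ∀ {n} → (Vec Bool n → Vec Bool n → Maybe Bool) → ℕ → Set
Dcc→ F t = OneWayProtocol F t × (∀ t' → t' Data.Nat.< t → ¬ OneWayProtocol F t')
  where import Data.Nat

NADTProtocol : ∀ {n} → PartialFn n → ℕ → Set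
NADTProtocol {n} f p =
  Σ (Vec (Vec Bool n) p) λ s →
  Σ (Vec Bool p → Bool) λ l →
    ∀ x b → f x ≡ just b → l (map (λ sᵢ → ⟨ sᵢ , x ⟩) s) ≡ b

NADT⊕ : ∀ {n} → PartialFn n → ℕ → Set
NADT⊕ f p = NADTProtocol f p × (∀ p' → p' Data.Nat.< p → ¬ NADTProtocol f p')
  where import Data.Nat

-- A one-bit message h(a) that lets Bob compute f(a ⊕ b) must separate any two
-- points x, x' of the domain on which f disagrees: h(a ⊕ x ⊕ x') ≠ h(a) for
-- every a. So every such "flip" d = x ⊕ x' lies in the complement of the
-- subspace P of periods of h, and since h has only two values, the flips form
-- a single coset t ⊕ P. Over GF(2) there is a linear functional s vanishing on
-- P with ⟨s,t⟩ = 1; it is 1 on every flip, so the single parity ⟨s,x⟩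
-- determines f on its domain. If there are no flips at all, f is constant on
-- its domain and zero bits of communication would suffice, contradicting
-- minimality of the one-bit protocol.
module Submission where

open import Level using (0ℓ)
open import Function using (_∘_)
open import Data.Nat using (ℕ; zero; suc; _<_; s≤s; z≤n)
open import Data.Bool using (Bool; true; false; not; _xor_; _∧_; _≟_)
open import Data.Bool.Properties
  using (xor-assoc; xor-same; xor-identityʳ; xor-comm; true-xor; not-injective; ¬-not;
         ∧-zeroʳ; ∧-identityʳ; ∧-distribˡ-xor)
open import Data.Maybe using (Maybe; just; nothing)
open import Data.Vec using (Vec; []; _∷_; [_]; replicate; map)
open import Data.Vec.Properties using (≡-dec; ∷-injectiveˡ)
open import Data.Vec.Relation.Binary.Pointwise.Inductive using (Pointwise-≡⇒≡; zipWith-assoc)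
open import Data.Product using (∃; _×_; _,_; proj₁; proj₂)
open import Data.Sum using (_⊎_; inj₁; inj₂)
open import Data.Empty using (⊥-elim)
open import Relation.Nullary using (¬_; Dec; yes; no; contradiction)
open import Relation.Nullary.Decidable using (map′; ¬?; _⊎-dec_; _×-dec_; decidable-stable)
open import Relation.Unary using (Pred; Decidable)
open import Relation.Binary.PropositionalEquality
  using (_≡_; _≢_; refl; sym; trans; cong; cong₂; subst; module ≡-Reasoning)
open ≡-Reasoning

open import Defs

private variable
  n k p : ℕ

⊕-assoc : (a b c : Vec Bool n) → (a ⊕ b) ⊕ c ≡ a ⊕ (b ⊕ c)
⊕-assoc a b c = Pointwise-≡⇒≡ (zipWith-assoc xor-assoc a b c)

⊕-identityˡ : (a : Vec Bool n) → replicate n false ⊕ a ≡ a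
⊕-identityˡ []      = refl
⊕-identityˡ (x ∷ a) = cong (x ∷_) (⊕-identityˡ a)

⊕-cancelˡ : (a b : Vec Bool n) → a ⊕ (a ⊕ b) ≡ b
⊕-cancelˡ []      []      = refl
⊕-cancelˡ (x ∷ a) (y ∷ b) =
  cong₂ _∷_ (trans (sym (xor-assoc x x y)) (cong (_xor y) (xor-same x))) (⊕-cancelˡ a b)

⊕-cancelʳ : (a b : Vec Bool n) → (a ⊕ b) ⊕ b ≡ a
⊕-cancelʳ []      []      = refl
⊕-cancelʳ (x ∷ a) (y ∷ b) =
  cong₂ _∷_ (trans (xor-assoc x y y) (trans (cong (x xor_) (xor-same y)) (xor-identityʳ x)))
            (⊕-cancelʳ a b)

⟨⟩-linear : (s a b : Vec Bool n) → ⟨ s , a ⊕ b ⟩ ≡ ⟨ s , a ⟩ xor ⟨ s , b ⟩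
⟨⟩-linear []      []      []      = refl
⟨⟩-linear (c ∷ s) (x ∷ a) (y ∷ b) = begin
  (c ∧ (x xor y)) xor ⟨ s , a ⊕ b ⟩
    ≡⟨ cong₂ _xor_ (∧-distribˡ-xor c x y) (⟨⟩-linear s a b) ⟩
  ((c ∧ x) xor (c ∧ y)) xor (⟨ s , a ⟩ xor ⟨ s , b ⟩)
    ≡⟨ xor-interchange (c ∧ x) (c ∧ y) ⟨ s , a ⟩ ⟨ s , b ⟩ ⟩
  ((c ∧ x) xor ⟨ s , a ⟩) xor ((c ∧ y) xor ⟨ s , b ⟩) ∎
  where
  xor-interchange : ∀ u v w z → (u xor v) xor (w xor z) ≡ (u xor w) xor (v xor z)
  xor-interchange u v w z = begin
    (u xor v) xor (w xor z) ≡⟨ xor-assoc u v (w xor z) ⟩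
    u xor (v xor (w xor z)) ≡⟨ cong (u xor_) (sym (xor-assoc v w z)) ⟩
    u xor ((v xor w) xor z) ≡⟨ cong (λ e → u xor (e xor z)) (xor-comm v w) ⟩
    u xor ((w xor v) xor z) ≡⟨ cong (u xor_) (xor-assoc w v z) ⟩
    u xor (w xor (v xor z)) ≡⟨ sym (xor-assoc u w (v xor z)) ⟩
    (u xor w) xor (v xor z) ∎

⟨⟩-zeroˡ : (a : Vec Bool n) → ⟨ replicate n false , a ⟩ ≡ false
⟨⟩-zeroˡ []      = refl
⟨⟩-zeroˡ (_ ∷ a) = ⟨⟩-zeroˡ a

⟨⟩-equal⇒⊕-false : (s a b : Vec Bool n) → ⟨ s , a ⟩ ≡ ⟨ s , b ⟩ → ⟨ s , a ⊕ b ⟩ ≡ false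
⟨⟩-equal⇒⊕-false s a b eq = trans (⟨⟩-linear s a b) (trans (cong (_xor ⟨ s , b ⟩) eq) (xor-same ⟨ s , b ⟩))

any? : {P : Pred (Vec Bool n) 0ℓ} → Decidable P → Dec (∃ P)
any? {zero}  P? = map′ ([] ,_) (λ { ([] , p) → p }) (P? [])
any? {suc n} {P} P? = map′ join split (any? (P? ∘ (false ∷_)) ⊎-dec any? (P? ∘ (true ∷_)))
  where
  join : ∃ (P ∘ (false ∷_)) ⊎ ∃ (P ∘ (true ∷_)) → ∃ P
  join (inj₁ (v , pv)) = false ∷ v , pv
  join (inj₂ (v , pv)) = true ∷ v , pv
  split : ∃ P → ∃ (P ∘ (false ∷_)) ⊎ ∃ (P ∘ (true ∷_))
  split (false ∷ v , pv) = inj₁ (v , pv)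
  split (true ∷ v , pv)  = inj₂ (v , pv)

all? : {P : Pred (Vec Bool n) 0ℓ} → Decidable P → Dec (∀ a → P a)
all? P? = map′ (λ ∄¬P a → decidable-stable (P? a) (λ ¬Pa → ∄¬P (a , ¬Pa)))
               (λ ∀P (a , ¬Pa) → ¬Pa (∀P a))
               (¬? (any? (¬? ∘ P?)))

record IsSubspace (Q : Pred (Vec Bool n) 0ℓ) : Set where
  field
    0∈       : Q (replicate n false)
    ⊕-closed : ∀ {a b} → Q a → Q b → Q (a ⊕ b)

Separates : Vec Bool n → Pred (Vec Bool n) 0ℓ → Vec Bool n → Set
Separates s Q t = ⟨ s , t ⟩ ≡ true × (∀ {a} → Q a → ⟨ s , a ⟩ ≡ false)

module Slice {Q : Pred (Vec Bool (suc n)) 0ℓ} (Q-sub : IsSubspace Q) where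
  open IsSubspace Q-sub

  Q₀ : Pred (Vec Bool n) 0ℓ
  Q₀ v = Q (false ∷ v)

  Q₀-sub : IsSubspace Q₀
  Q₀-sub = record { 0∈ = 0∈ ; ⊕-closed = ⊕-closed }

  -- A vector true ∷ w of Q lets every a be reduced into the slice Q₀ by
  -- adding it when the first coordinate is set; ⟨⟨s,w⟩ ∷ s, a⟩ computes ⟨s,·⟩
  -- of the reduction, so it inherits separation from s.
  module Reduce {w : Vec Bool n} (w∈ : Q (true ∷ w)) where
    reduce : Vec Bool (suc n) → Vec Bool n
    reduce (false ∷ v) = v
    reduce (true ∷ v)  = w ⊕ v

    reduce-∈ : ∀ {a} → Q a → Q₀ (reduce a)
    reduce-∈ {false ∷ v} a∈ = a∈
    reduce-∈ {true ∷ v}  a∈ = ⊕-closed w∈ a∈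

    reduce-∉ : ∀ {a} → ¬ Q a → ¬ Q₀ (reduce a)
    reduce-∉ {false ∷ v} a∉ = a∉
    reduce-∉ {true ∷ v}  a∉ r∈ = a∉ (subst (λ u → Q (true ∷ u)) (⊕-cancelˡ w v) (⊕-closed w∈ r∈))

    ⟨⟩-reduce : ∀ s a → ⟨ ⟨ s , w ⟩ ∷ s , a ⟩ ≡ ⟨ s , reduce a ⟩
    ⟨⟩-reduce s (false ∷ v) = cong (_xor ⟨ s , v ⟩) (∧-zeroʳ ⟨ s , w ⟩)
    ⟨⟩-reduce s (true ∷ v)  =
      trans (cong (_xor ⟨ s , v ⟩) (∧-identityʳ ⟨ s , w ⟩)) (sym (⟨⟩-linear s w v))

    lift : ∀ {s t} → Separates s Q₀ (reduce t) → Separates (⟨ s , w ⟩ ∷ s) Q t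
    lift {s} {t} (st , s-ann) =
      trans (⟨⟩-reduce s t) st , λ {a} a∈ → trans (⟨⟩-reduce s a) (s-ann (reduce-∈ a∈))

separate : {Q : Pred (Vec Bool n) 0ℓ} → Decidable Q → IsSubspace Q →
           ∀ {t} → ¬ Q t → ∃ λ s → Separates s Q t
separate {zero} _ Q-sub {[]} t∉ = contradiction (IsSubspace.0∈ Q-sub) t∉
separate {suc n} {Q} Q? Q-sub {t} t∉ with any? (Q? ∘ (true ∷_))
... | yes (w , w∈) =
  let open Slice Q-sub; open Reduce w∈
      s , s-sep = separate (Q? ∘ (false ∷_)) Q₀-sub (reduce-∉ t∉)
  in ⟨ s , w ⟩ ∷ s , lift {t = t} s-sep
... | no ∄w = separate-headless t t∉
  where
  open Slice Q-sub

  headless : ∀ {s} {b} → Separates s Q₀ b → ∀ {a} → Q a → ⟨ false ∷ s , a ⟩ ≡ false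
  headless (_ , s-ann) {false ∷ v} a∈ = s-ann a∈
  headless _           {true ∷ v}  a∈ = contradiction (v , a∈) ∄w

  separate-headless : ∀ t → ¬ Q t → ∃ λ s → Separates s Q t
  separate-headless (true ∷ v) _ = true ∷ replicate n false , cong not (⟨⟩-zeroˡ v) , ann
    where
    ann : ∀ {a} → Q a → ⟨ true ∷ replicate n false , a ⟩ ≡ false
    ann {false ∷ u} _  = ⟨⟩-zeroˡ u
    ann {true ∷ u}  a∈ = contradiction (u , a∈) ∄w
  separate-headless (false ∷ v) t∉ =
    let s , s-sep = separate (Q? ∘ (false ∷_)) Q₀-sub t∉
    in false ∷ s , proj₁ s-sep , headless s-sep

parities : Vec (Vec Bool n) p → Vec Bool n → Vec Bool p
parities s x = map (λ sᵢ → ⟨ sᵢ , x ⟩) s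

parities-⊕ : (s : Vec (Vec Bool n) p) (x y : Vec Bool n) →
             parities s (x ⊕ y) ≡ parities s x ⊕ parities s y
parities-⊕ []       x y = refl
parities-⊕ (sᵢ ∷ s) x y = cong₂ _∷_ (⟨⟩-linear sᵢ x y) (parities-⊕ s x y)

oneWay-of-NADT : {f : PartialFn n} → NADTProtocol f p → OneWayProtocol (xorLift f) p
oneWay-of-NADT (s , l , correct) =
  parities s , (λ m y → l (m ⊕ parities s y)) ,
  λ x y b fxy → trans (cong l (sym (parities-⊕ s x y))) (correct (x ⊕ y) b fxy)

DeterminedBy : PartialFn n → (Vec Bool n → Vec Bool k) → Set
DeterminedBy f g = ∀ {x x' v v'} → g x ≡ g x' → f x ≡ just v → f x' ≡ just v' → v ≡ v'

dom? : (r : Maybe Bool) → Dec (∃ λ v → r ≡ just v)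
dom? (just v) = yes (v , refl)
dom? nothing  = no λ { (_ , ()) }

module Factor {f : PartialFn n} (g : Vec Bool n → Vec Bool k) (determined : DeterminedBy f g) where
  InFibre : Vec Bool k → Pred (Vec Bool n) 0ℓ
  InFibre m x = g x ≡ m × ∃ λ v → f x ≡ just v

  valueOf : ∀ {m} → Dec (∃ (InFibre m)) → Bool
  valueOf (yes (_ , _ , v , _)) = v
  valueOf (no _)                = false

  factor : Vec Bool k → Bool
  factor m = valueOf (any? λ x → ≡-dec _≟_ (g x) m ×-dec dom? (f x))

  factor-correct : ∀ x v → f x ≡ just v → factor (g x) ≡ v
  factor-correct x v fx with any? (λ x' → ≡-dec _≟_ (g x') (g x) ×-dec dom? (f x'))
  ... | yes (x' , gx'≡gx , v' , fx') = determined gx'≡gx fx' fx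
  ... | no ∄x                        = contradiction (x , refl , v , fx) ∄x

NADT-of-determined : {f : PartialFn n} (s : Vec (Vec Bool n) p) →
                     DeterminedBy f (parities s) → NADTProtocol f p
NADT-of-determined s determined = s , factor , factor-correct
  where open Factor (parities s) determined

≢-≢⇒≡ : {a b c : Vec Bool 1} → a ≢ b → b ≢ c → a ≡ c
≢-≢⇒≡ {x ∷ []} {y ∷ []} {z ∷ []} a≢b b≢c =
  cong [_] (trans (¬-not (a≢b ∘ cong [_])) (sym (¬-not (b≢c ∘ cong [_] ∘ sym))))

module OneBit {f : PartialFn n} (h : Vec Bool n → Vec Bool 1) (φ : Vec Bool 1 → Vec Bool n → Bool)
              (correct : ∀ x y b → xorLift f x y ≡ just b → φ (h x) y ≡ b) where

  Period : Pred (Vec Bool n) 0ℓ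
  Period d = ∀ a → h (d ⊕ a) ≡ h a

  Flip : Pred (Vec Bool n) 0ℓ
  Flip d = ∀ a → h (d ⊕ a) ≢ h a

  Period? : Decidable Period
  Period? d = all? λ a → ≡-dec _≟_ (h (d ⊕ a)) (h a)

  Flip? : Decidable Flip
  Flip? d = all? λ a → ¬? (≡-dec _≟_ (h (d ⊕ a)) (h a))

  Period-sub : IsSubspace Period
  Period-sub = record
    { 0∈ = λ a → cong h (⊕-identityˡ a)
    ; ⊕-closed = λ {d} {e} d-per e-per a →
        trans (cong h (⊕-assoc d e a)) (trans (d-per (e ⊕ a)) (e-per a))
    }

  Flip⇒¬Period : ∀ {t} → Flip t → ¬ Period t
  Flip⇒¬Period t-flip t-per = t-flip (replicate n false) (t-per (replicate n false))

  Flip-Flip⇒Period : ∀ {d t} → Flip d → Flip t → Period (d ⊕ t)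
  Flip-Flip⇒Period {d} {t} d-flip t-flip a =
    trans (cong h (⊕-assoc d t a)) (≢-≢⇒≡ (d-flip (t ⊕ a)) (t-flip a))

  same-message⇒same-value : ∀ {x x' b v v'} → h (x ⊕ b) ≡ h (x' ⊕ b) →
                            f x ≡ just v → f x' ≡ just v' → v ≡ v'
  same-message⇒same-value {x} {x'} {b} {v} {v'} eq fx fx' = begin
    v                 ≡⟨ sym (correct (x ⊕ b) b v (subst (λ u → f u ≡ just v) (sym (⊕-cancelʳ x b)) fx)) ⟩
    φ (h (x ⊕ b)) b   ≡⟨ cong (λ m → φ m b) eq ⟩
    φ (h (x' ⊕ b)) b  ≡⟨ correct (x' ⊕ b) b v' (subst (λ u → f u ≡ just v') (sym (⊕-cancelʳ x' b)) fx') ⟩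
    v'                ∎

  disagreement⇒Flip : ∀ {x x' v v'} → f x ≡ just v → f x' ≡ just v' → v ≢ v' → Flip (x ⊕ x')
  disagreement⇒Flip {x} {x'} fx fx' v≢v' a eq =
    v≢v' (same-message⇒same-value {b = x' ⊕ a} (begin
      h (x ⊕ (x' ⊕ a))  ≡⟨ sym (cong h (⊕-assoc x x' a)) ⟩
      h ((x ⊕ x') ⊕ a)  ≡⟨ eq ⟩
      h a               ≡⟨ sym (cong h (⊕-cancelˡ x' a)) ⟩
      h (x' ⊕ (x' ⊕ a)) ∎) fx fx')

  agree-unless-Flip : ∀ {x x' v v'} → f x ≡ just v → f x' ≡ just v' → ¬ Flip (x ⊕ x') → v ≡ v'
  agree-unless-Flip {v = v} {v'} fx fx' ¬flip =
    decidable-stable (v ≟ v') (¬flip ∘ disagreement⇒Flip fx fx')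

  NADT-without-Flip : ¬ ∃ Flip → NADTProtocol f 0
  NADT-without-Flip ∄flip = NADT-of-determined [] λ _ fx fx' →
    agree-unless-Flip fx fx' (λ flip → ∄flip (_ , flip))

  NADT-with-Flip : ∀ {t} → Flip t → NADTProtocol f 1
  NADT-with-Flip {t} t-flip = NADT-of-determined [ s ] λ eq fx fx' →
    agree-unless-Flip fx fx' λ flip →
      contradiction (trans (sym (⟨⟩-equal⇒⊕-false s _ _ (∷-injectiveˡ eq))) (s-on-Flip flip)) λ ()
    where
    separation = separate Period? Period-sub (Flip⇒¬Period t-flip)
    s = proj₁ separation

    s-on-Flip : ∀ {d} → Flip d → ⟨ s , d ⟩ ≡ true
    s-on-Flip {d} d-flip = not-injective (begin
      not ⟨ s , d ⟩              ≡⟨ sym (true-xor ⟨ s , d ⟩) ⟩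
      true xor ⟨ s , d ⟩         ≡⟨ xor-comm true ⟨ s , d ⟩ ⟩
      ⟨ s , d ⟩ xor true         ≡⟨ sym (cong (⟨ s , d ⟩ xor_) (proj₁ (proj₂ separation))) ⟩
      ⟨ s , d ⟩ xor ⟨ s , t ⟩    ≡⟨ sym (⟨⟩-linear s d t) ⟩
      ⟨ s , d ⊕ t ⟩              ≡⟨ proj₂ (proj₂ separation) (Flip-Flip⇒Period d-flip t-flip) ⟩
      false                      ∎)

theorem32 : (n : ℕ) (f : PartialFn n) → Dcc→ (xorLift f) 1 → NADT⊕ f 1
theorem32 n f ((h , φ , correct) , minimal) = protocol , NADT-minimal
  where
  open OneBit {f = f} h φ correct

  no-zero-cost : ¬ NADTProtocol f 0
  no-zero-cost π = minimal 0 (s≤s z≤n) (oneWay-of-NADT π)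

  protocol : NADTProtocol f 1
  protocol with any? Flip?
  ... | yes (_ , t-flip) = NADT-with-Flip t-flip
  ... | no ∄flip         = ⊥-elim (no-zero-cost (NADT-without-Flip ∄flip))

  NADT-minimal : ∀ p → p < 1 → ¬ NADTProtocol f p
  NADT-minimal .zero (s≤s z≤n) = no-zero-cost
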